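{- Let $A,B,C$ be subsets of a finite abelian group $G$ such that $(A+B)\cap C=\emptyset$. If $2|A|+2|B|+|C|>2|G|$ and $C\neq\emptyset$, then there is a subgroup $K$ of $G$ such that $|A+K|+|B+K|=|G|$ and $C$ is contained in a single coset of $K$. -}

module Defs where

open import Level using (0ℓ)
open import Algebra.Bundles using (AbelianGroup)
open import Data.Nat using (ℕ)
open import Data.Fin using (Fin)
open import Data.Fin.Subset using (Subset; _∈_; _∉_; ∣_∣)
open import Data.Fin.Subset.Properties using (_∈?_)
open import Data.Fin.Properties using (any?)
open import Data.Product using (Σ; ∃; _×_; _,_)
open import Data.Vec using (tabulate)
open import Relation.Nullary.Decidable using (⌊_⌋; _×-dec_)
open import Relation.Binary.PropositionalEquality using (_≡_)
open import Data.Fin.Properties using (_≟_)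

record FiniteAbelianGroup : Set₁ where
  field
    abGroup : AbelianGroup 0ℓ 0ℓ
  open AbelianGroup abGroup public
  field
    size        : ℕ
    enum        : Fin size → Carrier
    index       : Carrier → Fin size
    enum-index  : ∀ x → enum (index x) ≈ x
    index-enum  : ∀ i → index (enum i) ≡ i
    index-cong  : ∀ {x y} → x ≈ y → index x ≡ index y

module _ (G : FiniteAbelianGroup) where
  open FiniteAbelianGroup G

  _⊕_ : Subset size → Subset size → Subset size
  A ⊕ B = tabulate λ x →
    ⌊ any? (λ a → any? (λ b →
        (a ∈? A) ×-dec ((b ∈? B) ×-dec (index (enum a ∙ enum b) ≟ x)))) ⌋

  record IsSubgroup (K : Subset size) : Set where
    field
      ε-mem  : index ε ∈ K
      ∙-mem  : ∀ {x y} → x ∈ K → y ∈ K → index (enum x ∙ enum y) ∈ K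
      ⁻¹-mem : ∀ {x} → x ∈ K → index (enum x ⁻¹) ∈ K

  InSingleCoset : Subset size → Subset size → Set
  InSingleCoset K C = ∃ λ g → ∀ c → c ∈ C → index (enum c ∙ g ⁻¹) ∈ K

-- Let U be the complement of A + B, so C ⊆ U, and write n = |G|. Kemperman's
-- inequality |A| + |B| ≤ |A + B| + r(s), where r(s) counts the representations
-- of s ∈ A + B, follows by induction on |B| using Dyson's e-transform. It makes U
-- closed under (u₁, u₂, u₃) ↦ u₁ + u₂ − u₃: otherwise the representations of
-- s = u₁ + u₂ − u₃ inject into the complement of A ∪ (u₃ − B), which has
-- n − |A| − |B| elements, and 2|A| + 2|B| + |U| ≤ 2n follows. Hence, for c ∈ C,
-- K = U − c is a subgroup with |K| = |U| and C ⊆ c + K. The sets A + K and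
-- c − (B + K) are disjoint, as a common point would put an element of A + B into
-- U, and they cover G: both are unions of K-cosets, so a point outside both
-- yields a whole K-coset outside A ∪ (c − B), which again gives
-- 2|A| + 2|B| + |U| ≤ 2n. So |A + K| + |B + K| = n.
-- Below the group is written multiplicatively, x // y = x ∙ y ⁻¹, and g ⊖ B is
-- the reflection g − B.

module Submission where

open import Level using (0ℓ)
open import Algebra.Bundles using (AbelianGroup; Group; RawGroup)
open import Algebra.Core using (Op₁; Op₂)
import Algebra.Morphism.GroupMonomorphism as GroupMonomorphism
open import Algebra.Morphism.Structures using (IsGroupMonomorphism)
open import Algebra.Structures using (IsAbelianGroup)
open import Data.Bool.Properties using (T-≡)
open import Data.Fin using (Fin) renaming (_≟_ to _≟ᶠ_)
open import Data.Fin.Properties using (any?)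
open import Data.Fin.Subset
  using (Subset; inside; outside; _∈_; _∉_; _⊆_; _⊂_; _∪_; _∩_; _─_; _-_; ∁; ⁅_⁆; ⊤; ∣_∣; Nonempty; Empty)
open import Data.Fin.Subset.Induction using (⊂-wellFounded)
open import Data.Fin.Subset.Properties
open import Data.Nat using (ℕ; suc; _+_; _*_; _≤_; _<_; _>_; z≤n; s≤s)
open import Data.Nat.Properties as ℕ using (module ≤-Reasoning)
open import Data.Nat.Tactic.RingSolver using (solve-∀)
open import Data.Product using (∃; ∃₂; _×_; _,_; proj₁; proj₂)
open import Data.Sum using (inj₁; inj₂)
open import Data.Vec using (tabulate; _∷_; []; there)
open import Data.Vec.Properties using (lookup∘tabulate; []=⇒lookup; lookup⇒[]=)
open import Function.Base using (case_of_)
open import Function.Bundles using (Equivalence)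
open import Induction.WellFounded using (Acc; acc)
open import Relation.Binary.PropositionalEquality
open import Relation.Nullary using (yes; no; contradiction)
open import Relation.Nullary.Decidable
  using (⌊_⌋; toWitness; fromWitness; _×-dec_; ¬?; decidable-stable)
open import Relation.Unary using (Pred; Decidable)

open import Defs using (FiniteAbelianGroup; module FiniteAbelianGroup)
import Defs

private
  variable
    m n : ℕ
    p q : Subset n
    x y : Fin n

select : {P : Pred (Fin n) 0ℓ} → Decidable P → Subset n
select P? = tabulate λ i → ⌊ P? i ⌋

module _ {P : Pred (Fin n) 0ℓ} (P? : Decidable P) where

  ∈-select⁺ : P x → x ∈ select P?
  ∈-select⁺ {x} Px = lookup⇒[]= x _ (trans (lookup∘tabulate _ x) (Equivalence.to T-≡ (fromWitness Px)))

  ∈-select⁻ : x ∈ select P? → P x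
  ∈-select⁻ {x} x∈ =
    toWitness (Equivalence.from T-≡ (trans (sym (lookup∘tabulate _ x)) ([]=⇒lookup x∈)))

preimage : (Fin m → Fin n) → Subset n → Subset m
preimage f p = select λ x → f x ∈? p

module _ (f : Fin m → Fin n) {p : Subset n} where

  ∈-preimage⁺ : f x ∈ p → x ∈ preimage f p
  ∈-preimage⁺ = ∈-select⁺ (λ y → f y ∈? p)

  ∈-preimage⁻ : x ∈ preimage f p → f x ∈ p
  ∈-preimage⁻ = ∈-select⁻ (λ y → f y ∈? p)

∣p∪q∣+∣p∩q∣≡∣p∣+∣q∣ : ∀ (p q : Subset n) → ∣ p ∪ q ∣ + ∣ p ∩ q ∣ ≡ ∣ p ∣ + ∣ q ∣
∣p∪q∣+∣p∩q∣≡∣p∣+∣q∣ []            []            = refl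
∣p∪q∣+∣p∩q∣≡∣p∣+∣q∣ (inside  ∷ p) (inside  ∷ q) =
  cong suc (trans (ℕ.+-suc _ _) (trans (cong suc (∣p∪q∣+∣p∩q∣≡∣p∣+∣q∣ p q)) (sym (ℕ.+-suc _ _))))
∣p∪q∣+∣p∩q∣≡∣p∣+∣q∣ (inside  ∷ p) (outside ∷ q) = cong suc (∣p∪q∣+∣p∩q∣≡∣p∣+∣q∣ p q)
∣p∪q∣+∣p∩q∣≡∣p∣+∣q∣ (outside ∷ p) (inside  ∷ q) =
  trans (cong suc (∣p∪q∣+∣p∩q∣≡∣p∣+∣q∣ p q)) (sym (ℕ.+-suc _ _))
∣p∪q∣+∣p∩q∣≡∣p∣+∣q∣ (outside ∷ p) (outside ∷ q) = ∣p∪q∣+∣p∩q∣≡∣p∣+∣q∣ p q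

∣p∪q∣≤∣p∣+∣q∣ : ∀ (p q : Subset n) → ∣ p ∪ q ∣ ≤ ∣ p ∣ + ∣ q ∣
∣p∪q∣≤∣p∣+∣q∣ p q = subst (∣ p ∪ q ∣ ≤_) (∣p∪q∣+∣p∩q∣≡∣p∣+∣q∣ p q) (ℕ.m≤m+n _ _)

Empty⇒∣p∣≡0 : Empty p → ∣ p ∣ ≡ 0
Empty⇒∣p∣≡0 {n} empty = trans (cong ∣_∣ (Empty-unique empty)) (∣⊥∣≡0 n)

Empty[p∩q]⇒∣p∪q∣≡∣p∣+∣q∣ : ∀ (p q : Subset n) → Empty (p ∩ q) → ∣ p ∪ q ∣ ≡ ∣ p ∣ + ∣ q ∣
Empty[p∩q]⇒∣p∪q∣≡∣p∣+∣q∣ p q disjoint = begin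
  ∣ p ∪ q ∣               ≡⟨ ℕ.+-identityʳ _ ⟨
  ∣ p ∪ q ∣ + 0           ≡⟨ cong (∣ p ∪ q ∣ +_) (Empty⇒∣p∣≡0 disjoint) ⟨
  ∣ p ∪ q ∣ + ∣ p ∩ q ∣   ≡⟨ ∣p∪q∣+∣p∩q∣≡∣p∣+∣q∣ p q ⟩
  ∣ p ∣ + ∣ q ∣           ∎
  where open ≡-Reasoning

∣p∣+∣∁p∣≡n : ∀ (p : Subset n) → ∣ p ∣ + ∣ ∁ p ∣ ≡ n
∣p∣+∣∁p∣≡n {n} p = begin
  ∣ p ∣ + ∣ ∁ p ∣   ≡⟨ Empty[p∩q]⇒∣p∪q∣≡∣p∣+∣q∣ p (∁ p) disjoint ⟨
  ∣ p ∪ ∁ p ∣       ≡⟨ cong ∣_∣ (p∪∁p≡⊤ p) ⟩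
  ∣ ⊤ {n} ∣         ≡⟨ ∣⊤∣≡n n ⟩
  n                 ∎
  where
  open ≡-Reasoning
  disjoint : Empty (p ∩ ∁ p)
  disjoint (x , x∈p∩∁p) = let x∈p , x∈∁p = x∈p∩q⁻ p (∁ p) x∈p∩∁p in x∈∁p⇒x∉p x∈∁p x∈p

⊤⊆p⇒∣p∣≡n : ∀ {n} {p : Subset n} → (∀ x → x ∈ p) → ∣ p ∣ ≡ n
⊤⊆p⇒∣p∣≡n {n} {p} all =
  ℕ.≤-antisym (∣p∣≤n p) (subst (_≤ ∣ p ∣) (∣⊤∣≡n n) (p⊆q⇒∣p∣≤∣q∣ {p = ⊤} λ {x} _ → all x))

x∈p─q⇒x∉q : ∀ {p q : Subset n} → x ∈ p ─ q → x ∉ q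
x∈p─q⇒x∉q {p = _ ∷ _} {q = _ ∷ _} (there x∈p─q) (there x∈q) = x∈p─q⇒x∉q x∈p─q x∈q

x∈p-y⇒x≢y : x ∈ p - y → x ≢ y
x∈p-y⇒x≢y {y = y} x∈p-y refl = x∈p─q⇒x∉q x∈p-y (x∈⁅x⁆ y)

x∈p⇒∣p∣≡1+∣p-x∣ : x ∈ p → ∣ p ∣ ≡ suc ∣ p - x ∣
x∈p⇒∣p∣≡1+∣p-x∣ {x = x} {p = p} x∈p = ℕ.≤-antisym ∣p∣≤1+∣p-x∣ (x∈p⇒∣p-x∣<∣p∣ x∈p)
  where
  p⊆[p-x]∪⁅x⁆ : p ⊆ (p - x) ∪ ⁅ x ⁆
  p⊆[p-x]∪⁅x⁆ {y} y∈p with y ≟ᶠ x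
  ... | yes refl = x∈p∪q⁺ (inj₂ (x∈⁅x⁆ x))
  ... | no  y≢x  = x∈p∪q⁺ (inj₁ (x∈p∧x≢y⇒x∈p-y y∈p y≢x))
  ∣p∣≤1+∣p-x∣ : ∣ p ∣ ≤ suc ∣ p - x ∣
  ∣p∣≤1+∣p-x∣ = begin
    ∣ p ∣                     ≤⟨ p⊆q⇒∣p∣≤∣q∣ p⊆[p-x]∪⁅x⁆ ⟩
    ∣ (p - x) ∪ ⁅ x ⁆ ∣       ≤⟨ ∣p∪q∣≤∣p∣+∣q∣ (p - x) ⁅ x ⁆ ⟩
    ∣ p - x ∣ + ∣ ⁅ x ⁆ ∣     ≡⟨ cong (∣ p - x ∣ +_) (∣⁅x⁆∣≡1 x) ⟩
    ∣ p - x ∣ + 1             ≡⟨ ℕ.+-comm _ 1 ⟩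
    suc ∣ p - x ∣             ∎
    where open ≤-Reasoning

injectiveOn⇒∣p∣≤∣q∣ : (f : Fin m → Fin n) →
  (∀ {x} → x ∈ p → f x ∈ q) → (∀ {x y} → x ∈ p → y ∈ p → f x ≡ f y → x ≡ y) →
  ∣ p ∣ ≤ ∣ q ∣
injectiveOn⇒∣p∣≤∣q∣ {p = p} f = go p (⊂-wellFounded p)
  where
  go : ∀ p {q} → Acc _⊂_ p →
       (∀ {x} → x ∈ p → f x ∈ q) → (∀ {x y} → x ∈ p → y ∈ p → f x ≡ f y → x ≡ y) →
       ∣ p ∣ ≤ ∣ q ∣
  go p {q} (acc rec) maps injective with nonempty? p
  ... | no  empty = subst (_≤ ∣ q ∣) (sym (Empty⇒∣p∣≡0 empty)) z≤n
  ... | yes (x , x∈p) = begin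
    ∣ p ∣              ≡⟨ x∈p⇒∣p∣≡1+∣p-x∣ x∈p ⟩
    suc ∣ p - x ∣      ≤⟨ s≤s (go (p - x) (rec (x∈p⇒p-x⊂p x∈p)) maps′ injective′) ⟩
    suc ∣ q - f x ∣    ≤⟨ x∈p⇒∣p-x∣<∣p∣ (maps x∈p) ⟩
    ∣ q ∣              ∎
    where
    open ≤-Reasoning
    y∈p-x⇒y∈p : ∀ {y} → y ∈ p - x → y ∈ p
    y∈p-x⇒y∈p = p─q⊆p p ⁅ x ⁆
    maps′ : ∀ {y} → y ∈ p - x → f y ∈ q - f x
    maps′ y∈p-x = x∈p∧x≢y⇒x∈p-y (maps (y∈p-x⇒y∈p y∈p-x))
      λ fy≡fx → x∈p-y⇒x≢y y∈p-x (injective (y∈p-x⇒y∈p y∈p-x) x∈p fy≡fx)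
    injective′ : ∀ {y z} → y ∈ p - x → z ∈ p - x → f y ≡ f z → y ≡ z
    injective′ y∈ z∈ = injective (y∈p-x⇒y∈p y∈) (y∈p-x⇒y∈p z∈)

inverse⇒∣preimage∣≡∣p∣ : (f : Fin m → Fin n) (g : Fin n → Fin m) →
  (∀ x → f (g x) ≡ x) → (∀ x → g (f x) ≡ x) → ∣ preimage f p ∣ ≡ ∣ p ∣
inverse⇒∣preimage∣≡∣p∣ {p = p} f g fg≗id gf≗id = ℕ.≤-antisym
  (injectiveOn⇒∣p∣≤∣q∣ f (∈-preimage⁻ f) λ _ _ → injective g gf≗id)
  (injectiveOn⇒∣p∣≤∣q∣ g (λ {x} x∈p → ∈-preimage⁺ f (subst (_∈ p) (sym (fg≗id x)) x∈p))
    λ _ _ → injective f fg≗id)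
  where
  injective : ∀ {A B : Set} {h : A → B} (k : B → A) → (∀ x → k (h x) ≡ x) → ∀ {x y} → h x ≡ h y → x ≡ y
  injective k kh≗id {x} {y} hx≡hy = trans (sym (kh≗id x)) (trans (cong k hx≡hy) (kh≗id y))

2*m+k≤2*n : ∀ {m k w n} → m + w ≤ n → m + k ≤ n + w → 2 * m + k ≤ 2 * n
2*m+k≤2*n {m} {k} {w} {n} m+w≤n m+k≤n+w = begin
  2 * m + k         ≡⟨ regroupˡ m k ⟩
  m + (m + k)       ≤⟨ ℕ.+-monoʳ-≤ m m+k≤n+w ⟩
  m + (n + w)       ≡⟨ regroupʳ m n w ⟩
  (m + w) + n       ≤⟨ ℕ.+-monoˡ-≤ n m+w≤n ⟩
  n + n             ≡⟨ double n ⟩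
  2 * n             ∎
  where
  open ≤-Reasoning
  regroupˡ : ∀ m k → 2 * m + k ≡ m + (m + k)
  regroupˡ = solve-∀
  regroupʳ : ∀ m n w → m + (n + w) ≡ (m + w) + n
  regroupʳ = solve-∀
  double : ∀ n → n + n ≡ 2 * n
  double = solve-∀

module FiniteAbelianGroupSumsets
  {n : ℕ} {mul : Op₂ (Fin n)} {unit : Fin n} {inv : Op₁ (Fin n)}
  (isAbelianGroup : IsAbelianGroup _≡_ mul unit inv) where

  abelianGroup : AbelianGroup 0ℓ 0ℓ
  abelianGroup = record { isAbelianGroup = isAbelianGroup }

  open AbelianGroup abelianGroup
    using (_∙_; ε; _⁻¹; assoc; comm; identityˡ; identityʳ; commutativeSemigroup; group)
  open Group group using (_//_)
  open import Algebra.Properties.AbelianGroup abelianGroup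
    using (⁻¹-anti-homo-//; ⁻¹-∙-comm; xyx⁻¹≈y; //-rightDividesˡ; //-rightDividesʳ; ∙-cancelʳ; ∙-cancelˡ; x≈z//y)
  open import Algebra.Properties.CommutativeSemigroup commutativeSemigroup
    using (interchange; xy∙z≈xz∙y)

  private
    variable
      a b u : Fin n
      A B X : Subset n

  x∙[g//x]≡g : ∀ x g → x ∙ (g // x) ≡ g
  x∙[g//x]≡g x g = trans (sym (assoc x g (x ⁻¹))) (xyx⁻¹≈y x g)

  g//[g//x]≡x : ∀ g x → g // (g // x) ≡ x
  g//[g//x]≡x g x = trans (cong (g ∙_) (⁻¹-anti-homo-// g x)) (x∙[g//x]≡g g x)

  g//[x∙y]≡g//x//y : ∀ g x y → g // (x ∙ y) ≡ g // x // y
  g//[x∙y]≡g//x//y g x y = trans (cong (g ∙_) (sym (⁻¹-∙-comm x y))) (sym (assoc g (x ⁻¹) (y ⁻¹)))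

  x//y//z≡x//z//y : ∀ x y z → x // y // z ≡ x // z // y
  x//y//z≡x//z//y x y z = begin
    x // y // z    ≡⟨ g//[x∙y]≡g//x//y x y z ⟨
    x // (y ∙ z)   ≡⟨ cong (x //_) (comm y z) ⟩
    x // (z ∙ y)   ≡⟨ g//[x∙y]≡g//x//y x z y ⟩
    x // z // y    ∎
    where open ≡-Reasoning

  x∙[y//z]≡y∙x//z : ∀ x y z → x ∙ (y // z) ≡ y ∙ x // z
  x∙[y//z]≡y∙x//z x y z = trans (sym (assoc x y (z ⁻¹))) (cong (_// z) (comm x y))

  infixl 8 _⊕_ _⊖_

  -- For the group of IndexGroup this unfolds to exactly Defs._⊕_.
  _⊕_ : Subset n → Subset n → Subset n
  A ⊕ B = select λ x → any? λ a → any? λ b → (a ∈? A) ×-dec ((b ∈? B) ×-dec (a ∙ b ≟ᶠ x))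

  ∈-⊕⁺ : a ∈ A → b ∈ B → a ∙ b ≡ x → x ∈ A ⊕ B
  ∈-⊕⁺ {a} {b = b} a∈A b∈B refl = ∈-select⁺ _ (a , b , a∈A , b∈B , refl)

  ∈-⊕⁻ : x ∈ A ⊕ B → ∃₂ λ a b → a ∈ A × b ∈ B × a ∙ b ≡ x
  ∈-⊕⁻ = ∈-select⁻ _

  _⊖_ : Fin n → Subset n → Subset n
  g ⊖ B = preimage (g //_) B

  ∣g⊖B∣≡∣B∣ : ∀ g B → ∣ g ⊖ B ∣ ≡ ∣ B ∣
  ∣g⊖B∣≡∣B∣ g B = inverse⇒∣preimage∣≡∣p∣ (g //_) (g //_) (g//[g//x]≡x g) (g//[g//x]≡x g)

  ∣A∣≤∣A⊕B∣ : b ∈ B → ∣ A ∣ ≤ ∣ A ⊕ B ∣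
  ∣A∣≤∣A⊕B∣ {b} b∈B = injectiveOn⇒∣p∣≤∣q∣ (_∙ b) (λ a∈A → ∈-⊕⁺ a∈A b∈B refl) λ _ _ → ∙-cancelʳ b _ _

  ∣B∣≤∣A∩s⊖B∣ : ∀ {s} → (∀ {b} → b ∈ B → s // b ∈ A) → ∣ B ∣ ≤ ∣ A ∩ s ⊖ B ∣
  ∣B∣≤∣A∩s⊖B∣ {B} {A} {s} s//B⊆A = begin
    ∣ B ∣          ≡⟨ ∣g⊖B∣≡∣B∣ s B ⟨
    ∣ s ⊖ B ∣      ≤⟨ p⊆q⇒∣p∣≤∣q∣ s⊖B⊆A∩s⊖B ⟩
    ∣ A ∩ s ⊖ B ∣  ∎
    where
    open ≤-Reasoning
    s⊖B⊆A∩s⊖B : s ⊖ B ⊆ A ∩ s ⊖ B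
    s⊖B⊆A∩s⊖B {x} x∈s⊖B =
      x∈p∩q⁺ (subst (_∈ A) (g//[g//x]≡x s x) (s//B⊆A (∈-preimage⁻ (s //_) x∈s⊖B)) , x∈s⊖B)

  module DysonTransform (A B : Subset n) (e : Fin n) where

    B∙e : Subset n
    B∙e = preimage (_// e) B

    A⁺ : Subset n
    A⁺ = A ∪ B∙e

    B⁻ : Subset n
    B⁻ = B ∩ preimage (_∙ e) A

    A⁺⊕B⁻⊆A⊕B : A⁺ ⊕ B⁻ ⊆ A ⊕ B
    A⁺⊕B⁻⊆A⊕B x∈A⁺⊕B⁻ with ∈-⊕⁻ x∈A⁺⊕B⁻
    ... | a , b , a∈A⁺ , b∈B⁻ , refl with x∈p∩q⁻ B _ b∈B⁻ | x∈p∪q⁻ A B∙e a∈A⁺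
    ...   | b∈B , _     | inj₁ a∈A   = ∈-⊕⁺ a∈A b∈B refl
    ...   | _   , b∙e∈A | inj₂ a∈B∙e =
      ∈-⊕⁺ (∈-preimage⁻ (_∙ e) b∙e∈A) (∈-preimage⁻ (_// e) a∈B∙e) [b∙e]∙[a//e]≡a∙b
      where
      open ≡-Reasoning
      [b∙e]∙[a//e]≡a∙b : (b ∙ e) ∙ (a // e) ≡ a ∙ b
      [b∙e]∙[a//e]≡a∙b = begin
        (b ∙ e) ∙ (a // e)  ≡⟨ x∙[y//z]≡y∙x//z (b ∙ e) a e ⟩
        a ∙ (b ∙ e) // e    ≡⟨ cong (_// e) (assoc a b e) ⟨
        a ∙ b ∙ e // e      ≡⟨ //-rightDividesʳ e (a ∙ b) ⟩
        a ∙ b               ∎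

    ∣A∣+∣B∣≤∣A⁺∣+∣B⁻∣ : ∣ A ∣ + ∣ B ∣ ≤ ∣ A⁺ ∣ + ∣ B⁻ ∣
    ∣A∣+∣B∣≤∣A⁺∣+∣B⁻∣ = begin
      ∣ A ∣ + ∣ B ∣          ≡⟨ cong (∣ A ∣ +_) ∣B∙e∣≡∣B∣ ⟨
      ∣ A ∣ + ∣ B∙e ∣        ≡⟨ ∣p∪q∣+∣p∩q∣≡∣p∣+∣q∣ A B∙e ⟨
      ∣ A⁺ ∣ + ∣ A ∩ B∙e ∣   ≤⟨ ℕ.+-monoʳ-≤ ∣ A⁺ ∣ ∣A∩B∙e∣≤∣B⁻∣ ⟩
      ∣ A⁺ ∣ + ∣ B⁻ ∣        ∎
      where
      open ≤-Reasoning
      ∣B∙e∣≡∣B∣ : ∣ B∙e ∣ ≡ ∣ B ∣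
      ∣B∙e∣≡∣B∣ = inverse⇒∣preimage∣≡∣p∣ (_// e) (_∙ e) (//-rightDividesʳ e) (//-rightDividesˡ e)
      ∣A∩B∙e∣≤∣B⁻∣ : ∣ A ∩ B∙e ∣ ≤ ∣ B⁻ ∣
      ∣A∩B∙e∣≤∣B⁻∣ = injectiveOn⇒∣p∣≤∣q∣ (_// e)
        (λ {x} x∈A∩B∙e → let x∈A , x∈B∙e = x∈p∩q⁻ A B∙e x∈A∩B∙e in
          x∈p∩q⁺ (∈-preimage⁻ (_// e) x∈B∙e , ∈-preimage⁺ (_∙ e) (subst (_∈ A) (sym (//-rightDividesˡ e x)) x∈A)))
        λ _ _ → ∙-cancelʳ (e ⁻¹) _ _

    ∣A⁺∩s⊖B⁻∣≤∣A∩s⊖B∣ : ∀ s → ∣ A⁺ ∩ s ⊖ B⁻ ∣ ≤ ∣ A ∩ s ⊖ B ∣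
    ∣A⁺∩s⊖B⁻∣≤∣A∩s⊖B∣ s = injectiveOn⇒∣p∣≤∣q∣ φ φ-maps φ-injective
      where
      ψ : Fin n → Fin n
      ψ x = (s // x) ∙ e

      s//ψx≡x//e : ∀ x → s // ψ x ≡ x // e
      s//ψx≡x//e x = trans (g//[x∙y]≡g//x//y s (s // x) e) (cong (_// e) (g//[g//x]≡x s x))

      ψ-involutive : ∀ x → ψ (ψ x) ≡ x
      ψ-involutive x = trans (cong (_∙ e) (s//ψx≡x//e x)) (//-rightDividesˡ e x)

      module _ {x} (x∈ : x ∈ A⁺ ∩ s ⊖ B⁻) where
        private
          s//x∈B⁻ : s // x ∈ B⁻
          s//x∈B⁻ = ∈-preimage⁻ (s //_) (proj₂ (x∈p∩q⁻ A⁺ _ x∈))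

        s//x∈B : s // x ∈ B
        s//x∈B = proj₁ (x∈p∩q⁻ B _ s//x∈B⁻)

        ψx∈A : ψ x ∈ A
        ψx∈A = ∈-preimage⁻ (_∙ e) (proj₂ (x∈p∩q⁻ B _ s//x∈B⁻))

        x∉A⇒x//e∈B : x ∉ A → x // e ∈ B
        x∉A⇒x//e∈B x∉A with x∈p∪q⁻ A B∙e (proj₁ (x∈p∩q⁻ A⁺ _ x∈))
        ... | inj₁ x∈A   = contradiction x∈A x∉A
        ... | inj₂ x∈B∙e = ∈-preimage⁻ (_// e) x∈B∙e

      φ : Fin n → Fin n
      φ x with x ∈? A
      ... | yes _ = x
      ... | no  _ = ψ x

      φ-maps : ∀ {x} → x ∈ A⁺ ∩ s ⊖ B⁻ → φ x ∈ A ∩ s ⊖ B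
      φ-maps {x} x∈ with x ∈? A
      ... | yes x∈A = x∈p∩q⁺ (x∈A , ∈-preimage⁺ (s //_) (s//x∈B x∈))
      ... | no  x∉A = x∈p∩q⁺ (ψx∈A x∈ ,
        ∈-preimage⁺ (s //_) (subst (_∈ B) (sym (s//ψx≡x//e x)) (x∉A⇒x//e∈B x∈ x∉A)))

      φ-injective : ∀ {x y} → x ∈ A⁺ ∩ s ⊖ B⁻ → y ∈ A⁺ ∩ s ⊖ B⁻ → φ x ≡ φ y → x ≡ y
      φ-injective {x} {y} x∈ y∈ with x ∈? A | y ∈? A
      ... | yes _   | yes _   = λ x≡y → x≡y
      ... | no  _   | no  _   = λ ψx≡ψy →
        trans (sym (ψ-involutive x)) (trans (cong ψ ψx≡ψy) (ψ-involutive y))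
      ... | yes _   | no  y∉A = λ x≡ψy →
        contradiction (subst (_∈ A) (trans (cong ψ x≡ψy) (ψ-involutive y)) (ψx∈A x∈)) y∉A
      ... | no  x∉A | yes _   = λ ψx≡y →
        contradiction (subst (_∈ A) (trans (cong ψ (sym ψx≡y)) (ψ-involutive x)) (ψx∈A y∈)) x∉A

  ∣A∣+∣B∣≤∣A⊕B∣+∣A∩s⊖B∣ : ∀ A B {s} → s ∈ A ⊕ B → ∣ A ∣ + ∣ B ∣ ≤ ∣ A ⊕ B ∣ + ∣ A ∩ s ⊖ B ∣
  ∣A∣+∣B∣≤∣A⊕B∣+∣A∩s⊖B∣ A B = go A (⊂-wellFounded B)
    where
    go : ∀ A {B} → Acc _⊂_ B → ∀ {s} → s ∈ A ⊕ B → ∣ A ∣ + ∣ B ∣ ≤ ∣ A ⊕ B ∣ + ∣ A ∩ s ⊖ B ∣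
    go A {B} (acc rec) {s} s∈A⊕B with ∈-⊕⁻ s∈A⊕B | any? (λ b → (b ∈? B) ×-dec ¬? (s // b ∈? A))
    ... | _ , b₀ , _ , b₀∈B , _ | no ∄b =
      ℕ.+-mono-≤ (∣A∣≤∣A⊕B∣ b₀∈B) (∣B∣≤∣A∩s⊖B∣ λ {b} b∈B →
        decidable-stable (s // b ∈? A) λ s//b∉A → ∄b (b , b∈B , s//b∉A))
    -- With e = a₀ // b the element b₀ leaves B⁻, because b₀ ∙ e = s // b ∉ A,
    -- while s = (s // b) ∙ b stays in A⁺ ⊕ B⁻.
    ... | a₀ , b₀ , a₀∈A , b₀∈B , refl | yes (b , b∈B , s//b∉A) = begin
      ∣ A ∣ + ∣ B ∣                    ≤⟨ ∣A∣+∣B∣≤∣A⁺∣+∣B⁻∣ ⟩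
      ∣ A⁺ ∣ + ∣ B⁻ ∣                  ≤⟨ go A⁺ (rec B⁻⊂B) s∈A⁺⊕B⁻ ⟩
      ∣ A⁺ ⊕ B⁻ ∣ + ∣ A⁺ ∩ s ⊖ B⁻ ∣    ≤⟨ ℕ.+-mono-≤ (p⊆q⇒∣p∣≤∣q∣ A⁺⊕B⁻⊆A⊕B) (∣A⁺∩s⊖B⁻∣≤∣A∩s⊖B∣ s) ⟩
      ∣ A ⊕ B ∣ + ∣ A ∩ s ⊖ B ∣        ∎
      where
      open ≤-Reasoning
      open DysonTransform A B (a₀ // b)
      b₀∙e≡s//b : b₀ ∙ (a₀ // b) ≡ s // b
      b₀∙e≡s//b = x∙[y//z]≡y∙x//z b₀ a₀ b
      B⁻⊂B : B⁻ ⊂ B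
      B⁻⊂B = p∩q⊆p B _ , b₀ , b₀∈B , λ b₀∈B⁻ →
        s//b∉A (subst (_∈ A) b₀∙e≡s//b (∈-preimage⁻ (_∙ (a₀ // b)) (proj₂ (x∈p∩q⁻ B _ b₀∈B⁻))))
      s//b∈B∙e : s // b ∈ B∙e
      s//b∈B∙e = ∈-preimage⁺ (_// (a₀ // b))
        (subst (λ t → t // (a₀ // b) ∈ B) b₀∙e≡s//b (subst (_∈ B) (sym (//-rightDividesʳ (a₀ // b) b₀)) b₀∈B))
      b∈B⁻ : b ∈ B⁻
      b∈B⁻ = x∈p∩q⁺ (b∈B , ∈-preimage⁺ (_∙ (a₀ // b)) (subst (_∈ A) (sym (x∙[g//x]≡g b a₀)) a₀∈A))
      s∈A⁺⊕B⁻ : s ∈ A⁺ ⊕ B⁻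
      s∈A⁺⊕B⁻ = ∈-⊕⁺ (x∈p∪q⁺ (inj₂ s//b∈B∙e)) b∈B⁻ (//-rightDividesˡ b s)

  ∣A∣+∣B∣+∣∁[A∪u⊖B]∣≡n : u ∉ A ⊕ B → ∣ A ∣ + ∣ B ∣ + ∣ ∁ (A ∪ u ⊖ B) ∣ ≡ n
  ∣A∣+∣B∣+∣∁[A∪u⊖B]∣≡n {u} {A} {B} u∉A⊕B = begin
    ∣ A ∣ + ∣ B ∣ + ∣ ∁ (A ∪ u ⊖ B) ∣        ≡⟨ cong (λ k → k + ∣ ∁ (A ∪ u ⊖ B) ∣) ∣A∣+∣B∣≡∣A∪u⊖B∣ ⟩
    ∣ A ∪ u ⊖ B ∣ + ∣ ∁ (A ∪ u ⊖ B) ∣        ≡⟨ ∣p∣+∣∁p∣≡n (A ∪ u ⊖ B) ⟩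
    n                                        ∎
    where
    open ≡-Reasoning
    A∩u⊖B-empty : Empty (A ∩ u ⊖ B)
    A∩u⊖B-empty (a , a∈A∩u⊖B) = let a∈A , a∈u⊖B = x∈p∩q⁻ A _ a∈A∩u⊖B in
      u∉A⊕B (∈-⊕⁺ a∈A (∈-preimage⁻ (u //_) a∈u⊖B) (x∙[g//x]≡g a u))
    ∣A∣+∣B∣≡∣A∪u⊖B∣ : ∣ A ∣ + ∣ B ∣ ≡ ∣ A ∪ u ⊖ B ∣
    ∣A∣+∣B∣≡∣A∪u⊖B∣ = trans (cong (∣ A ∣ +_) (sym (∣g⊖B∣≡∣B∣ u B)))
                            (sym (Empty[p∩q]⇒∣p∪q∣≡∣p∣+∣q∣ A (u ⊖ B) A∩u⊖B-empty))

  record IsSubgroup (K : Subset n) : Set where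
    field
      ε-mem  : ε ∈ K
      ∙-mem  : x ∈ K → y ∈ K → x ∙ y ∈ K
      ⁻¹-mem : x ∈ K → x ⁻¹ ∈ K

  module Periodicity {K : Subset n} (K-subgroup : IsSubgroup K) where
    open IsSubgroup K-subgroup

    Periodic : Subset n → Set
    Periodic X = ∀ {x k} → k ∈ K → x ∈ X → x ∙ k ∈ X

    X⊆X⊕K : X ⊆ X ⊕ K
    X⊆X⊕K {x = x} x∈X = ∈-⊕⁺ x∈X ε-mem (identityʳ x)

    ⊕-periodic : ∀ X → Periodic (X ⊕ K)
    ⊕-periodic X {k = k} k∈K x∈X⊕K with ∈-⊕⁻ x∈X⊕K
    ... | a , k′ , a∈X , k′∈K , refl = ∈-⊕⁺ a∈X (∙-mem k′∈K k∈K) (sym (assoc a k′ k))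

    ⊖-periodic : ∀ g → Periodic X → Periodic (g ⊖ X)
    ⊖-periodic {X} g X-periodic {x} {k} k∈K x∈g⊖X = ∈-preimage⁺ (g //_)
      (subst (_∈ X) (sym (g//[x∙y]≡g//x//y g x k)) (X-periodic (⁻¹-mem k∈K) (∈-preimage⁻ (g //_) x∈g⊖X)))

    ∪-periodic : ∀ {X Y} → Periodic X → Periodic Y → Periodic (X ∪ Y)
    ∪-periodic {X} {Y} X-periodic Y-periodic k∈K x∈X∪Y with x∈p∪q⁻ X Y x∈X∪Y
    ... | inj₁ x∈X = x∈p∪q⁺ (inj₁ (X-periodic k∈K x∈X))
    ... | inj₂ x∈Y = x∈p∪q⁺ (inj₂ (Y-periodic k∈K x∈Y))

    ∁-periodic : Periodic X → Periodic (∁ X)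
    ∁-periodic {X} X-periodic {x} {k} k∈K x∈∁X = x∉p⇒x∈∁p λ x∙k∈X →
      x∈∁p⇒x∉p x∈∁X (subst (_∈ X) (//-rightDividesʳ k x) (X-periodic (⁻¹-mem k∈K) x∙k∈X))

    periodic⇒∣K∣≤∣X∣ : Periodic X → x ∈ X → ∣ K ∣ ≤ ∣ X ∣
    periodic⇒∣K∣≤∣X∣ {x = x} X-periodic x∈X =
      injectiveOn⇒∣p∣≤∣q∣ (x ∙_) (λ k∈K → X-periodic k∈K x∈X) λ _ _ → ∙-cancelˡ x _ _

  ∣A∩s⊖B∣≤∣∁[A∪u₃⊖B]∣ : ∀ {u₁ u₂ u₃} → u₁ ∉ A ⊕ B → u₂ ∉ A ⊕ B →
                         ∣ A ∩ (u₁ ∙ u₂ // u₃) ⊖ B ∣ ≤ ∣ ∁ (A ∪ u₃ ⊖ B) ∣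
  ∣A∩s⊖B∣≤∣∁[A∪u₃⊖B]∣ {A} {B} {u₁} {u₂} {u₃} u₁∉A⊕B u₂∉A⊕B =
    injectiveOn⇒∣p∣≤∣q∣ φ φ-maps λ _ _ → φ-injective
    where
    s : Fin n
    s = u₁ ∙ u₂ // u₃

    φ : Fin n → Fin n
    φ a = u₃ // (u₁ // a)

    u₂//φa≡s//a : ∀ a → u₂ // φ a ≡ s // a
    u₂//φa≡s//a a = begin
      u₂ // (u₃ // (u₁ // a))   ≡⟨ cong (u₂ ∙_) (⁻¹-anti-homo-// u₃ (u₁ // a)) ⟩
      u₂ ∙ (u₁ // a // u₃)      ≡⟨ x∙[y//z]≡y∙x//z u₂ (u₁ // a) u₃ ⟩
      (u₁ // a) ∙ u₂ // u₃      ≡⟨ cong (_// u₃) (comm (u₁ // a) u₂) ⟩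
      u₂ ∙ (u₁ // a) // u₃      ≡⟨ cong (_// u₃) (x∙[y//z]≡y∙x//z u₂ u₁ a) ⟩
      u₁ ∙ u₂ // a // u₃        ≡⟨ x//y//z≡x//z//y (u₁ ∙ u₂) a u₃ ⟩
      s // a                    ∎
      where open ≡-Reasoning

    φ-maps : ∀ {a} → a ∈ A ∩ s ⊖ B → φ a ∈ ∁ (A ∪ u₃ ⊖ B)
    φ-maps {a} a∈A∩s⊖B = x∉p⇒x∈∁p λ φa∈A∪u₃⊖B → case x∈p∪q⁻ A _ φa∈A∪u₃⊖B of λ where
        (inj₁ φa∈A)    → u₂∉A⊕B
          (∈-⊕⁺ φa∈A (subst (_∈ B) (sym (u₂//φa≡s//a a)) s//a∈B) (x∙[g//x]≡g (φ a) u₂))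
        (inj₂ φa∈u₃⊖B) → u₁∉A⊕B
          (∈-⊕⁺ a∈A (subst (_∈ B) (g//[g//x]≡x u₃ (u₁ // a)) (∈-preimage⁻ (u₃ //_) φa∈u₃⊖B))
            (x∙[g//x]≡g a u₁))
      where
      a∈A : a ∈ A
      a∈A = proj₁ (x∈p∩q⁻ A _ a∈A∩s⊖B)
      s//a∈B : s // a ∈ B
      s//a∈B = ∈-preimage⁻ (s //_) (proj₂ (x∈p∩q⁻ A _ a∈A∩s⊖B))

    φ-injective : ∀ {a a′} → φ a ≡ φ a′ → a ≡ a′
    φ-injective {a} {a′} φa≡φa′ = begin
      a                        ≡⟨ g//[g//x]≡x u₁ a ⟨
      u₁ // (u₁ // a)          ≡⟨ cong (u₁ //_) (g//[g//x]≡x u₃ (u₁ // a)) ⟨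
      u₁ // (u₃ // φ a)        ≡⟨ cong (λ t → u₁ // (u₃ // t)) φa≡φa′ ⟩
      u₁ // (u₃ // φ a′)       ≡⟨ cong (u₁ //_) (g//[g//x]≡x u₃ (u₁ // a′)) ⟩
      u₁ // (u₁ // a′)         ≡⟨ g//[g//x]≡x u₁ a′ ⟩
      a′                       ∎
      where open ≡-Reasoning

  module ComplementOfSumset
    (A B : Subset n) (dense : 2 * n < 2 * (∣ A ∣ + ∣ B ∣) + ∣ ∁ (A ⊕ B) ∣) where

    U : Subset n
    U = ∁ (A ⊕ B)

    U-closed : ∀ {u₁ u₂ u₃} → u₁ ∈ U → u₂ ∈ U → u₃ ∈ U → u₁ ∙ u₂ // u₃ ∈ U
    U-closed {u₁} {u₂} {u₃} u₁∈U u₂∈U u₃∈U = x∉p⇒x∈∁p λ s∈A⊕B →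
      ℕ.<⇒≱ dense (2*m+k≤2*n (ℕ.≤-reflexive (∣A∣+∣B∣+∣∁[A∪u⊖B]∣≡n (x∈∁p⇒x∉p u₃∈U))) (begin
        ∣ A ∣ + ∣ B ∣ + ∣ U ∣               ≤⟨ ℕ.+-monoˡ-≤ ∣ U ∣ (∣A∣+∣B∣≤∣A⊕B∣+∣A∩s⊖B∣ A B s∈A⊕B) ⟩
        ∣ A ⊕ B ∣ + ∣ A ∩ s ⊖ B ∣ + ∣ U ∣   ≤⟨ ℕ.+-monoˡ-≤ ∣ U ∣ (ℕ.+-monoʳ-≤ ∣ A ⊕ B ∣ ∣A∩s⊖B∣≤∣W∣) ⟩
        ∣ A ⊕ B ∣ + ∣ W ∣ + ∣ U ∣           ≡⟨ ℕ.+-assoc (∣ A ⊕ B ∣) (∣ W ∣) (∣ U ∣) ⟩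
        ∣ A ⊕ B ∣ + (∣ W ∣ + ∣ U ∣)         ≡⟨ cong (∣ A ⊕ B ∣ +_) (ℕ.+-comm (∣ W ∣) (∣ U ∣)) ⟩
        ∣ A ⊕ B ∣ + (∣ U ∣ + ∣ W ∣)         ≡⟨ ℕ.+-assoc (∣ A ⊕ B ∣) (∣ U ∣) (∣ W ∣) ⟨
        ∣ A ⊕ B ∣ + ∣ U ∣ + ∣ W ∣           ≡⟨ cong (_+ ∣ W ∣) (∣p∣+∣∁p∣≡n (A ⊕ B)) ⟩
        n + ∣ W ∣                           ∎))
      where
      open ≤-Reasoning
      s : Fin n
      s = u₁ ∙ u₂ // u₃
      W : Subset n
      W = ∁ (A ∪ u₃ ⊖ B)
      ∣A∩s⊖B∣≤∣W∣ : ∣ A ∩ s ⊖ B ∣ ≤ ∣ W ∣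
      ∣A∩s⊖B∣≤∣W∣ = ∣A∩s⊖B∣≤∣∁[A∪u₃⊖B]∣ (x∈∁p⇒x∉p u₁∈U) (x∈∁p⇒x∉p u₂∈U)

    module Coset {c : Fin n} (c∈U : c ∈ U) where

      K : Subset n
      K = preimage (_∙ c) U

      K-subgroup : IsSubgroup K
      K-subgroup = record
        { ε-mem  = ∈-preimage⁺ (_∙ c) (subst (_∈ U) (sym (identityˡ c)) c∈U)
        ; ∙-mem  = λ {x} {y} x∈K y∈K → ∈-preimage⁺ (_∙ c) (subst (_∈ U) ([x∙c]∙[y∙c]//c≡x∙y∙c x y)
            (U-closed (∈-preimage⁻ (_∙ c) x∈K) (∈-preimage⁻ (_∙ c) y∈K) c∈U))
        ; ⁻¹-mem = λ {x} x∈K → ∈-preimage⁺ (_∙ c) (subst (_∈ U) (c∙c//[x∙c]≡x⁻¹∙c x)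
            (U-closed c∈U c∈U (∈-preimage⁻ (_∙ c) x∈K)))
        }
        where
        open ≡-Reasoning
        [x∙c]∙[y∙c]//c≡x∙y∙c : ∀ x y → (x ∙ c) ∙ (y ∙ c) // c ≡ x ∙ y ∙ c
        [x∙c]∙[y∙c]//c≡x∙y∙c x y = begin
          (x ∙ c) ∙ (y ∙ c) // c    ≡⟨ assoc (x ∙ c) (y ∙ c) (c ⁻¹) ⟩
          (x ∙ c) ∙ (y ∙ c // c)    ≡⟨ cong ((x ∙ c) ∙_) (//-rightDividesʳ c y) ⟩
          (x ∙ c) ∙ y               ≡⟨ xy∙z≈xz∙y x c y ⟩
          x ∙ y ∙ c                 ∎
        c∙c//[x∙c]≡x⁻¹∙c : ∀ x → c ∙ c // (x ∙ c) ≡ x ⁻¹ ∙ c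
        c∙c//[x∙c]≡x⁻¹∙c x = begin
          c ∙ c // (x ∙ c)          ≡⟨ g//[x∙y]≡g//x//y (c ∙ c) x c ⟩
          c ∙ c // x // c           ≡⟨ x//y//z≡x//z//y (c ∙ c) x c ⟩
          c ∙ c // c // x           ≡⟨ cong (_// x) (//-rightDividesʳ c c) ⟩
          c // x                    ≡⟨ comm c (x ⁻¹) ⟩
          x ⁻¹ ∙ c                  ∎

      open IsSubgroup K-subgroup
      open Periodicity K-subgroup

      U⊆K∙c : ∀ {u} → u ∈ U → u // c ∈ K
      U⊆K∙c {u} u∈U = ∈-preimage⁺ (_∙ c) (subst (_∈ U) (sym (//-rightDividesˡ c u)) u∈U)

      ∣K∣≡∣U∣ : ∣ K ∣ ≡ ∣ U ∣
      ∣K∣≡∣U∣ = inverse⇒∣preimage∣≡∣p∣ (_∙ c) (_// c) (//-rightDividesˡ c) (//-rightDividesʳ c)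

      Y : Subset n
      Y = c ⊖ (B ⊕ K)

      A⊕K∩Y-empty : Empty (A ⊕ K ∩ Y)
      A⊕K∩Y-empty (x , x∈A⊕K∩Y) with x∈p∩q⁻ (A ⊕ K) Y x∈A⊕K∩Y
      ... | x∈A⊕K , x∈Y with ∈-⊕⁻ x∈A⊕K | ∈-⊕⁻ (∈-preimage⁻ (c //_) x∈Y)
      ... | a , k , a∈A , k∈K , refl | b , k′ , b∈B , k′∈K , b∙k′≡c//x =
        x∈∁p⇒x∉p (∈-preimage⁻ (_∙ c) (⁻¹-mem (∙-mem k∈K k′∈K)))
          (∈-⊕⁺ a∈A b∈B a∙b≡[k∙k′]⁻¹∙c)
        where
        open ≡-Reasoning
        a∙b≡[k∙k′]⁻¹∙c : a ∙ b ≡ (k ∙ k′) ⁻¹ ∙ c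
        a∙b≡[k∙k′]⁻¹∙c = begin
          a ∙ b                 ≡⟨ x≈z//y (a ∙ b) (k ∙ k′) c (begin
            a ∙ b ∙ (k ∙ k′)      ≡⟨ interchange a b k k′ ⟩
            (a ∙ k) ∙ (b ∙ k′)    ≡⟨ cong ((a ∙ k) ∙_) b∙k′≡c//x ⟩
            (a ∙ k) ∙ (c // (a ∙ k)) ≡⟨ x∙[g//x]≡g (a ∙ k) c ⟩
            c                     ∎) ⟩
          c // (k ∙ k′)         ≡⟨ comm c ((k ∙ k′) ⁻¹) ⟩
          (k ∙ k′) ⁻¹ ∙ c       ∎

      A⊕K∪Y-covers : ∀ x → x ∈ A ⊕ K ∪ Y
      A⊕K∪Y-covers x = decidable-stable (x ∈? A ⊕ K ∪ Y) λ x∉A⊕K∪Y →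
        ℕ.<⇒≱ dense (2*m+k≤2*n ∣A∣+∣B∣+∣W∣≤n (begin
          ∣ A ∣ + ∣ B ∣ + ∣ U ∣   ≤⟨ ℕ.+-monoʳ-≤ (∣ A ∣ + ∣ B ∣) (∣U∣≤∣W∣ (x∉p⇒x∈∁p x∉A⊕K∪Y)) ⟩
          ∣ A ∣ + ∣ B ∣ + ∣ W ∣   ≤⟨ ∣A∣+∣B∣+∣W∣≤n ⟩
          n                       ≤⟨ ℕ.m≤m+n n (∣ W ∣) ⟩
          n + ∣ W ∣               ∎))
        where
        open ≤-Reasoning
        R : Subset n
        R = ∁ (A ⊕ K ∪ Y)
        W : Subset n
        W = ∁ (A ∪ c ⊖ B)
        ∣A∣+∣B∣+∣W∣≤n : ∣ A ∣ + ∣ B ∣ + ∣ W ∣ ≤ n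
        ∣A∣+∣B∣+∣W∣≤n = ℕ.≤-reflexive (∣A∣+∣B∣+∣∁[A∪u⊖B]∣≡n (x∈∁p⇒x∉p c∈U))
        R⊆W : R ⊆ W
        R⊆W = p⊆q⇒∁p⊇∁q λ {y} y∈A∪c⊖B → case x∈p∪q⁻ A (c ⊖ B) y∈A∪c⊖B of λ where
          (inj₁ y∈A)   → x∈p∪q⁺ (inj₁ (X⊆X⊕K y∈A))
          (inj₂ y∈c⊖B) → x∈p∪q⁺ (inj₂ (∈-preimage⁺ (c //_) (X⊆X⊕K (∈-preimage⁻ (c //_) y∈c⊖B))))
        ∣U∣≤∣W∣ : x ∈ R → ∣ U ∣ ≤ ∣ W ∣
        ∣U∣≤∣W∣ x∈R = begin
          ∣ U ∣   ≡⟨ ∣K∣≡∣U∣ ⟨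
          ∣ K ∣   ≤⟨ periodic⇒∣K∣≤∣X∣ (∁-periodic (∪-periodic (⊕-periodic A) (⊖-periodic c (⊕-periodic B)))) x∈R ⟩
          ∣ R ∣   ≤⟨ p⊆q⇒∣p∣≤∣q∣ R⊆W ⟩
          ∣ W ∣   ∎

      ∣A⊕K∣+∣B⊕K∣≡n : ∣ A ⊕ K ∣ + ∣ B ⊕ K ∣ ≡ n
      ∣A⊕K∣+∣B⊕K∣≡n = begin
        ∣ A ⊕ K ∣ + ∣ B ⊕ K ∣   ≡⟨ cong (∣ A ⊕ K ∣ +_) (∣g⊖B∣≡∣B∣ c (B ⊕ K)) ⟨
        ∣ A ⊕ K ∣ + ∣ Y ∣       ≡⟨ Empty[p∩q]⇒∣p∪q∣≡∣p∣+∣q∣ (A ⊕ K) Y A⊕K∩Y-empty ⟨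
        ∣ A ⊕ K ∪ Y ∣           ≡⟨ ⊤⊆p⇒∣p∣≡n A⊕K∪Y-covers ⟩
        n                       ∎
        where open ≡-Reasoning

-- The group structure of G carried over to the indices Fin size, where
-- equality is _≡_.
module IndexGroup (G : FiniteAbelianGroup) where
  open FiniteAbelianGroup G
    using (abGroup; size; enum; index; enum-index; index-enum; index-cong; _∙_; ε; _⁻¹; reflexive)

  rawGroup : RawGroup 0ℓ 0ℓ
  rawGroup = record
    { Carrier = Fin size
    ; _≈_     = _≡_
    ; _∙_     = λ i j → index (enum i ∙ enum j)
    ; ε       = index ε
    ; _⁻¹     = λ i → index (enum i ⁻¹)
    }

  enum-isGroupMonomorphism : IsGroupMonomorphism rawGroup (AbelianGroup.rawGroup abGroup) enum
  enum-isGroupMonomorphism = record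
    { isGroupHomomorphism = record
      { isMonoidHomomorphism = record
        { isMagmaHomomorphism = record
          { isRelHomomorphism = record { cong = λ i≡j → reflexive (cong enum i≡j) }
          ; homo = λ i j → enum-index (enum i ∙ enum j)
          }
        ; ε-homo = enum-index ε
        }
      ; ⁻¹-homo = λ i → enum-index (enum i ⁻¹)
      }
    ; injective = λ {i} {j} enum-i≈enum-j →
        trans (sym (index-enum i)) (trans (index-cong enum-i≈enum-j) (index-enum j))
    }

  isAbelianGroup : IsAbelianGroup _≡_ (RawGroup._∙_ rawGroup) (RawGroup.ε rawGroup) (RawGroup._⁻¹ rawGroup)
  isAbelianGroup = GroupMonomorphism.isAbelianGroup enum-isGroupMonomorphism
    (AbelianGroup.isAbelianGroup abGroup)

open Defs using (_⊕_; IsSubgroup; InSingleCoset)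

lemma3p3 : (G : FiniteAbelianGroup) →
    let open FiniteAbelianGroup G in
    (A B C : Subset size) →
    (∀ x → x ∈ _⊕_ G A B → x ∉ C) →
    2 * ∣ A ∣ + 2 * ∣ B ∣ + ∣ C ∣ > 2 * size →
    Nonempty C →
    ∃ λ (K : Subset size) → IsSubgroup G K ×
      (∣ _⊕_ G A K ∣ + ∣ _⊕_ G B K ∣ ≡ size) × InSingleCoset G K C
lemma3p3 G A B C A⊕B∩C-empty dense (c , c∈C) =
  K , isSubgroup , ∣A⊕K∣+∣B⊕K∣≡n , enum c , C⊆K∙c
  where
  open FiniteAbelianGroup G
    using (size; enum; index; index-cong; enum-index; _∙_; _⁻¹; ∙-cong) renaming (refl to ≈-refl)
  module S = FiniteAbelianGroupSumsets (IndexGroup.isAbelianGroup G)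

  C⊆U : C ⊆ ∁ (A S.⊕ B)
  C⊆U {x} x∈C = x∉p⇒x∈∁p λ x∈A⊕B → A⊕B∩C-empty x x∈A⊕B x∈C

  dense′ : 2 * size < 2 * (∣ A ∣ + ∣ B ∣) + ∣ ∁ (A S.⊕ B) ∣
  dense′ = begin-strict
    2 * size                        <⟨ dense ⟩
    2 * ∣ A ∣ + 2 * ∣ B ∣ + ∣ C ∣    ≡⟨ cong (_+ ∣ C ∣) (ℕ.*-distribˡ-+ 2 (∣ A ∣) (∣ B ∣)) ⟨
    2 * (∣ A ∣ + ∣ B ∣) + ∣ C ∣      ≤⟨ ℕ.+-monoʳ-≤ (2 * (∣ A ∣ + ∣ B ∣)) (p⊆q⇒∣p∣≤∣q∣ C⊆U) ⟩
    2 * (∣ A ∣ + ∣ B ∣) + ∣ ∁ (A S.⊕ B) ∣ ∎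
    where open ≤-Reasoning

  open S.ComplementOfSumset A B dense′
  open Coset (C⊆U c∈C)

  isSubgroup : IsSubgroup G K
  isSubgroup = record { S.IsSubgroup K-subgroup }

  C⊆K∙c : ∀ x → x ∈ C → index (enum x ∙ enum c ⁻¹) ∈ K
  C⊆K∙c x x∈C = subst (_∈ K) (index-cong (∙-cong ≈-refl (enum-index _))) (U⊆K∙c (C⊆U x∈C))
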